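{- Let $H$ be a hypergraph with at least one edge and let $p\in(0,1)$. Then $\min\{\lceil p|e|\rceil \mid e\in E(H)\}\leq b_{L,p}(H)$.
   Context: A hypergraph $H=(V(H),E(H))$ has a finite nonempty vertex set and a finite collection $E(H)$ of subsets of $V(H)$ called edges (parallel edges allowed). For a proportion $p\in(0,1)$, the proportion-based propagation rule is: if at some time step at least $\lceil p|e|\rceil$ vertices of an edge $e$ are on fire, then in the next time step all vertices of $e$ catch fire; burned vertices stay burned. A set $S\subseteq V(H)$ is a lazy burning set if, setting all of $S$ on fire at once and then repeatedly applying the propagation rule, every vertex eventually catches fire; $b_{L,p}(H)$ is the minimum size of a lazy burning set.
   Formalization: The proportion p ranges only over the rationals in the interval (0,1). -}

module Defs where

open import Data.Bool using (Bool; true; false; if_then_else_)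
open import Data.Nat using (ℕ; suc)
open import Data.Integer as ℤ using (ℤ; +_; _⊓_)
open import Data.Rational as ℚ using (ℚ; _/_; _*_; ceiling)
open import Data.Fin.Subset using (Subset; ∣_∣; _∪_; _∩_; ⊥; ⊤)
open import Data.List using (List; []; _∷_; foldr)
open import Data.List.NonEmpty using (List⁺; _∷_; toList)
open import Data.Product using (Σ; ∃; _×_)

-- A hypergraph on the vertex set Fin n (n ≥ 1, enforced in the theorem),
-- with a list of edges (parallel edges allowed).  Each edge is a subset
-- of the vertex set.
record Hypergraph (n : ℕ) : Set where
  constructor hypergraph
  field
    edges : List (Subset n)

open Hypergraph public

⌈p*_⌉ : ℚ → ℕ → ℤ
⌈p*_⌉ p k = ceiling (p * ((+ k) / 1))

threshold : ∀ {n} → ℚ → Subset n → ℤ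
threshold p e = ⌈p*_⌉ p ∣ e ∣

triggered : ∀ {n} → ℚ → Subset n → Subset n → Bool
triggered p S e = threshold p e ℤ.≤ᵇ (+ ∣ e ∩ S ∣)

step : ∀ {n} → ℚ → Hypergraph n → Subset n → Subset n
step p H S = foldr (λ e acc → if triggered p S e then e ∪ acc else acc) S (edges H)

burnedAfter : ∀ {n} → ℚ → Hypergraph n → Subset n → ℕ → Subset n
burnedAfter p H S 0       = S
burnedAfter p H S (suc k) = step p H (burnedAfter p H S k)

IsLazyBurningSet : ∀ {n} → ℚ → Hypergraph n → Subset n → Set
IsLazyBurningSet p H S = ∃ λ k → burnedAfter p H S k ≡ ⊤
  where open import Relation.Binary.PropositionalEquality using (_≡_)

IsLazyBurningNumber : ∀ {n} → ℚ → Hypergraph n → ℕ → Set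
IsLazyBurningNumber p H b =
  (Σ (Subset _) λ S → IsLazyBurningSet p H S × ∣ S ∣ ≡ b)
  × (∀ S → IsLazyBurningSet p H S → b ≤ ∣ S ∣)
  where open import Relation.Binary.PropositionalEquality using (_≡_)
        open import Data.Nat using (_≤_)

minThreshold : ∀ {n} → ℚ → List⁺ (Subset n) → ℤ
minThreshold p (e ∷ es) = foldr (λ f acc → threshold p f ⊓ acc) (threshold p e) es

-- A burning set smaller than every threshold ⌈p|e|⌉ triggers no edge, so it
-- never grows and must already be the whole vertex set.  But the vertex set
-- has at least |e| ≥ ⌈p|e|⌉ elements for any edge e, as p ≤ 1.
module Submission where

open import Defs
open import Data.Nat using (ℕ; suc)
open import Data.Integer using (_≤_; +_)
open import Data.Rational using (ℚ; 0ℚ; 1ℚ; _<_)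
open import Data.List.NonEmpty using (List⁺; toList)
open import Data.Fin.Subset using (Subset)

import Data.Nat as ℕ
open import Data.Integer as ℤ using (ℤ; _/ℕ_; _⊓_; +≤+)
open import Data.Integer.Properties as ℤ
  using (≤-trans; neg-mono-≤; neg-involutive; neg-distribˡ-*; *-identityʳ; *-monoʳ-≤-nonNeg;
         i<j⇒suc[i]≤j; ≰⇒>; ≤⇒≯; <-≤-trans; <⇒≱; i⊓j≤i; i⊓j≤j; ≤ᵇ⇒≤; _≤?_)
open import Data.Integer.DivMod using (n<s[n/ℕd]*d; div-pos-is-/ℕ)
import Data.Rational as ℚ
import Data.Rational.Properties as ℚ
open import Data.Nat.Coprimality using (Coprime; 1-coprimeTo)
import Data.Nat.Coprimality as Coprime
open import Data.Bool using (true; false; if_then_else_; T)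
open import Data.List using (List; []; _∷_; foldr)
open import Data.List.NonEmpty using (_∷_)
open import Data.List.Membership.Propositional using (_∈_)
open import Data.List.Relation.Unary.Any using (here; there)
open import Data.Fin.Subset using (∣_∣; _∩_; _∪_; ⊤)
open import Data.Fin.Subset.Properties using (∣p∣≤n; ∣⊤∣≡n; ∣p∩q∣≤∣q∣)
open import Data.Product using (_,_)
open import Function using (_∘_)
open import Relation.Nullary using (yes; no; contradiction)
open import Relation.Binary.PropositionalEquality using (_≡_; refl; sym; trans; cong; subst)

i*d≤n⇒i≤n/ℕd : ∀ i n d .{{_ : ℕ.NonZero d}} → i ℤ.* + d ≤ n → i ≤ n /ℕ d
i*d≤n⇒i≤n/ℕd i n d i*d≤n with i ≤? n /ℕ d
... | yes i≤n/d = i≤n/d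
... | no  i≰n/d = contradiction (n<s[n/ℕd]*d n d) (≤⇒≯ (begin
  ℤ.suc (n /ℕ d) ℤ.* + d  ≤⟨ *-monoʳ-≤-nonNeg (+ d) (i<j⇒suc[i]≤j (≰⇒> i≰n/d)) ⟩
  i ℤ.* + d               ≤⟨ i*d≤n ⟩
  n                       ∎))
  where open ℤ.≤-Reasoning

-[-n/d]≤z : ∀ n z d .{{_ : ℕ.NonZero d}} → n ≤ z ℤ.* + d → ℤ.- (ℤ.- n ℤ./ + d) ≤ z
-[-n/d]≤z n z d n≤z*d = begin
  ℤ.- (ℤ.- n ℤ./ + d)  ≡⟨ cong ℤ.-_ (div-pos-is-/ℕ (ℤ.- n) d) ⟩
  ℤ.- (ℤ.- n /ℕ d)     ≤⟨ neg-mono-≤ (i*d≤n⇒i≤n/ℕd (ℤ.- z) (ℤ.- n) d -z*d≤-n) ⟩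
  ℤ.- ℤ.- z            ≡⟨ neg-involutive z ⟩
  z                    ∎
  where
  open ℤ.≤-Reasoning
  -z*d≤-n : ℤ.- z ℤ.* + d ≤ ℤ.- n
  -z*d≤-n = subst (_≤ ℤ.- n) (neg-distribˡ-* z (+ d)) (neg-mono-≤ n≤z*d)

-- The rational ceiling is defined through the floor of the negation, whose
-- numerator only reduces once the sign of the numerator is known.
ceiling-≤ : ∀ q z → ℚ.↥ q ≤ z ℤ.* ℚ.↧ q → ℚ.ceiling q ≤ z
ceiling-≤ (ℚ.mkℚ ℤ.-[1+ n ] d _) z = -[-n/d]≤z ℤ.-[1+ n ] z (suc d)
ceiling-≤ (ℚ.mkℚ (+ 0)      d _) z = -[-n/d]≤z (+ 0)      z (suc d)
ceiling-≤ (ℚ.mkℚ ℤ.+[1+ n ] d _) z = -[-n/d]≤z ℤ.+[1+ n ] z (suc d)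

⌈p*k⌉≤k : ∀ {p} → p ℚ.≤ 1ℚ → ∀ k → ⌈p*_⌉ p k ≤ + k
⌈p*k⌉≤k {p} p≤1 k = subst (λ x → ℚ.ceiling (p ℚ.* x) ≤ + k) (sym k/1≡k)
  (ceiling-≤ (p ℚ.* k′) (+ k) (unfold {p ℚ.* k′} p*k≤k))
  where
  k-coprime-1 : Coprime k 1
  k-coprime-1 = Coprime.sym (1-coprimeTo k)
  k′ : ℚ
  k′ = ℚ.mkℚ (+ k) 0 k-coprime-1
  k/1≡k : + k ℚ./ 1 ≡ k′
  k/1≡k = ℚ.normalize-coprime k-coprime-1
  p*k≤k : p ℚ.* k′ ℚ.≤ k′
  p*k≤k = subst (p ℚ.* k′ ℚ.≤_) (ℚ.*-identityˡ k′) (ℚ.*-monoʳ-≤-nonNeg k′ p≤1)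
  unfold : ∀ {q} → q ℚ.≤ k′ → ℚ.↥ q ≤ + k ℤ.* ℚ.↧ q
  unfold {q} (ℚ.*≤* le) = subst (_≤ + k ℤ.* ℚ.↧ q) (*-identityʳ (ℚ.↥ q)) le

module _ {A : Set} (g : A → ℤ) where

  foldr-⊓-≤-init : ∀ t (xs : List A) → foldr (λ x acc → g x ⊓ acc) t xs ≤ t
  foldr-⊓-≤-init t []       = ℤ.≤-refl
  foldr-⊓-≤-init t (x ∷ xs) = ≤-trans (i⊓j≤j _ _) (foldr-⊓-≤-init t xs)

  foldr-⊓-≤-∈ : ∀ t {x} (xs : List A) → x ∈ xs → foldr (λ x acc → g x ⊓ acc) t xs ≤ g x
  foldr-⊓-≤-∈ t (x ∷ xs) (here refl) = i⊓j≤i _ _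
  foldr-⊓-≤-∈ t (y ∷ xs) (there x∈xs) = ≤-trans (i⊓j≤j _ _) (foldr-⊓-≤-∈ t xs x∈xs)

module _ {n : ℕ} (p : ℚ) where

  minThreshold-≤ : ∀ E {e : Subset n} → e ∈ toList E → minThreshold p E ≤ threshold p e
  minThreshold-≤ (e ∷ es) (here refl) = foldr-⊓-≤-init (threshold p) (threshold p e) es
  minThreshold-≤ (e ∷ es) (there e∈es) = foldr-⊓-≤-∈ (threshold p) (threshold p e) es e∈es

  triggered⇒threshold≤∣S∣ : ∀ S (e : Subset n) → T (triggered p S e) → threshold p e ≤ + ∣ S ∣
  triggered⇒threshold≤∣S∣ S e trig = ≤-trans (≤ᵇ⇒≤ trig) (+≤+ (∣p∩q∣≤∣q∣ e S))

  ∣S∣<threshold⇒untriggered : ∀ S (e : Subset n) → + ∣ S ∣ ℤ.< threshold p e →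
                              triggered p S e ≡ false
  ∣S∣<threshold⇒untriggered S e ∣S∣<thr with triggered p S e in eq
  ... | false = refl
  ... | true  = contradiction (triggered⇒threshold≤∣S∣ S e (subst T (sym eq) _)) (<⇒≱ ∣S∣<thr)

  foldr-untriggered : ∀ (S : Subset n) es → (∀ {e} → e ∈ es → triggered p S e ≡ false) →
                      foldr (λ e acc → if triggered p S e then e ∪ acc else acc) S es ≡ S
  foldr-untriggered S []       _      = refl
  foldr-untriggered S (e ∷ es) untrig rewrite untrig (here refl) =
    foldr-untriggered S es (untrig ∘ there)

  burnedAfter-stable : ∀ (H : Hypergraph n) S → step p H S ≡ S → ∀ k → burnedAfter p H S k ≡ S
  burnedAfter-stable H S stable 0       = refl
  burnedAfter-stable H S stable (suc k) rewrite burnedAfter-stable H S stable k = stable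

  lazyBurningSet-below-thresholds⇒⊤ : ∀ (H : Hypergraph n) S → IsLazyBurningSet p H S →
    (∀ {e} → e ∈ edges H → + ∣ S ∣ ℤ.< threshold p e) → S ≡ ⊤
  lazyBurningSet-below-thresholds⇒⊤ H S (k , burned) small =
    trans (sym (burnedAfter-stable H S stable k)) burned
    where
    stable : step p H S ≡ S
    stable = foldr-untriggered S (edges H) (λ {e} e∈H → ∣S∣<threshold⇒untriggered S e (small e∈H))

theorem2p13 : (m : ℕ) (E : List⁺ (Subset (suc m))) (p : ℚ) → 0ℚ < p → p < 1ℚ →
    (b : ℕ) → IsLazyBurningNumber p (hypergraph (toList E)) b →
    minThreshold p E ≤ + b
theorem2p13 m E@(e ∷ _) p _ p<1 b ((S , burns , refl) , _) with minThreshold p E ≤? + ∣ S ∣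
... | yes min≤b = min≤b
... | no  min≰b = contradiction (begin
  minThreshold p E  ≤⟨ minThreshold-≤ p E (here refl) ⟩
  threshold p e     ≤⟨ ⌈p*k⌉≤k (ℚ.<⇒≤ p<1) ∣ e ∣ ⟩
  + ∣ e ∣           ≤⟨ +≤+ (∣p∣≤n e) ⟩
  + suc m           ≡⟨ cong +_ (sym (∣⊤∣≡n (suc m))) ⟩
  + ∣ ⊤ {suc m} ∣   ≡⟨ cong (λ X → + ∣ X ∣) (sym S≡⊤) ⟩
  + ∣ S ∣           ∎) min≰b
  where
  open ℤ.≤-Reasoning
  S≡⊤ : S ≡ ⊤
  S≡⊤ = lazyBurningSet-below-thresholds⇒⊤ p (hypergraph (toList E)) S burns
          (λ e∈E → <-≤-trans (≰⇒> min≰b) (minThreshold-≤ p E e∈E))
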